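{- Let $\alpha\geq 0$ be an integer, $p$ an odd prime and $H$ a finite abelian group. Let $G\cong\mathbb{Z}_p\oplus H\oplus\mathbb{Z}_{2^\alpha}$ and $G_1=\mathbb{Z}_p\oplus H\oplus\mathbb{Z}_{2^{\alpha+3}}$, and let $G_2=\{(w,4x): w\in\mathbb{Z}_p\oplus H,\ x\in\mathbb{Z}_{2^{\alpha+3}}\}\cong\mathbb{Z}_p\oplus H\oplus\mathbb{Z}_{2^{\alpha+1}}$, a subgroup of $G_1$. If there exists an MRS$^*_G(p,4;|G|/(4p))$, then there exists an IMRS$^*_{G_1\setminus G_2}(p,4;6|G|/(4p))$.
   Context: $\mathbb{Z}_v$ denotes the additive group of integers modulo $v$ ($\mathbb{Z}_1$ trivial). For a finite abelian group $(K,+)$ and a subset $T\subseteq K$ with $|T|=xyz$, an IMRS$^*_{T}(x,y;z)$ is a collection of $z$ arrays of size $x\times y$ whose entries are elements of $T$, each element of $T$ appearing exactly once among all the arrays, such that every row sum and every column sum in every array equals $0\in K$. An MRS$^*_K(x,y;z)$ is the same notion with $T=K$. -}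

module Defs where

open import Level using (0ℓ)
open import Data.Nat using (ℕ; zero; suc; _+_; _*_; _^_; NonZero; _/_)
open import Data.Nat.Properties using (m*n≢0; m^n≢0)
open import Data.Nat.DivMod using (_mod_)
open import Data.Nat.Primality using (Prime; prime⇒nonZero)
open import Data.Fin using (Fin; toℕ)
open import Data.Product using (Σ; _×_; _,_; ∃)
open import Data.Unit using (⊤)
open import Relation.Nullary using (¬_)
open import Relation.Binary.PropositionalEquality using (_≡_)
open import Algebra.Structures using (IsAbelianGroup)
open import Function.Bundles using (_↔_)

-- A bare additive structure: carrier, addition and zero.
-- (The notions MRS*/IMRS* only use + and 0.)
record AddStr : Set₁ where
  field
    Carrier : Set
    _⊕_     : Carrier → Carrier → Carrier
    𝟘       : Carrier

record FinAbGroup : Set₁ where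
  field
    Carrier        : Set
    _∙_            : Carrier → Carrier → Carrier
    ε              : Carrier
    _⁻¹            : Carrier → Carrier
    isAbelianGroup : IsAbelianGroup _≡_ _∙_ ε _⁻¹
    size           : ℕ
    enum           : Fin size ↔ Carrier

toAddStr : FinAbGroup → AddStr
toAddStr H = record { Carrier = Carrier ; _⊕_ = _∙_ ; 𝟘 = ε }
  where open FinAbGroup H

Zmod : (v : ℕ) .{{_ : NonZero v}} → AddStr
Zmod v = record
  { Carrier = Fin v
  ; _⊕_ = λ a b → (toℕ a + toℕ b) mod v
  ; 𝟘 = 0 mod v }

_⊞_ : AddStr → AddStr → AddStr
K ⊞ L = record
  { Carrier = K.Carrier × L.Carrier
  ; _⊕_ = λ { (a , b) (c , d) → (a K.⊕ c) , (b L.⊕ d) }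
  ; 𝟘 = K.𝟘 , L.𝟘 }
  where
    module K = AddStr K
    module L = AddStr L

sumFin : (K : AddStr) (n : ℕ) → (Fin n → AddStr.Carrier K) → AddStr.Carrier K
sumFin K zero    f = AddStr.𝟘 K
sumFin K (suc n) f = AddStr._⊕_ K (f Fin.zero) (sumFin K n (λ i → f (Fin.suc i)))
  where import Data.Fin as Fin

record IMRS (K : AddStr) (T : AddStr.Carrier K → Set) (x y z : ℕ) : Set where
  open AddStr K
  field
    A          : Fin z → Fin x → Fin y → Carrier
    entriesInT : ∀ k i j → T (A k i j)
    exactlyOnce : ∀ t → T t →
                  Σ (Fin z × Fin x × Fin y) λ { (k , i , j) →
                    (A k i j ≡ t) ×
                    (∀ k' i' j' → A k' i' j' ≡ t → (k' , i' , j') ≡ (k , i , j)) }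
    rowSums    : ∀ k i → sumFin K y (λ j → A k i j) ≡ 𝟘
    colSums    : ∀ k j → sumFin K x (λ i → A k i j) ≡ 𝟘

MRS : (K : AddStr) (x y z : ℕ) → Set
MRS K x y z = IMRS K (λ _ → ⊤) x y z

Grp : (p : ℕ) → Prime p → FinAbGroup → ℕ → AddStr
Grp p pp H a = Zmod p {{prime⇒nonZero pp}} ⊞ (toAddStr H ⊞ Zmod (2 ^ a) {{m^n≢0 2 a}})

card : ℕ → FinAbGroup → ℕ → ℕ
card p H a = p * FinAbGroup.size H * 2 ^ a

-- n / (4p)  (floor division; p prime so 4p ≠ 0)
div4p : ℕ → (p : ℕ) → Prime p → ℕ
div4p n p pp = _/_ n (4 * p) {{m*n≢0 4 p {{_}} {{prime⇒nonZero pp}}}}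

notInG2 : (p : ℕ) (pp : Prime p) (H : FinAbGroup) (α : ℕ) →
          AddStr.Carrier (Grp p pp H (α + 3)) → Set
notInG2 p pp H α (u , h , c) =
  ¬ (Σ (Fin (2 ^ (α + 3))) λ x →
       c ≡ _mod_ (4 * toℕ x) (2 ^ (α + 3)) {{m^n≢0 2 (α + 3)}})

module Submission where

-- Write the last coordinate of G₁ as 8x + r − 3 with x ∈ ℤ_{2^α} and r ∈ {0, …, 7}.  It lies in
-- G₂ = 4ℤ exactly when r ≡ 3 (mod 4), so G₁ ∖ G₂ ≅ G × D for the six digits D = {0,1,2,4,5,6},
-- whose offsets r − 3 are ±1, ±2, ±3.  Each array of the given MRS* is replaced by six arrays, the
-- s-th one lifting the entry in cell (i, j) with the digit π_ij(s), where every π_ij permutes D.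
-- A lifted line sums to 8 · (a multiple of 2^α) plus the sum of its offsets, so it vanishes as soon
-- as the offsets cancel along every row and column.  For p odd such a pattern exists: rows 0, 1, 2
-- use ρ⁰, ρ¹, ρ² for a 3-cycle ρ on D whose orbits have offsets {−3, 1, 2} and {3, −1, −2}, the
-- remaining rows alternate between id and the negation r ↦ 6 − r, and the columns apply id and
-- the negation alternately.

open import Defs
open import Data.Nat using (ℕ; _+_; _*_)
open import Data.Nat.Divisibility using (_∣_)
open import Data.Nat.Primality using (Prime)
open import Relation.Nullary using (¬_)

open import Data.Nat.Base using (zero; suc; _∸_; _<_; _≤_; NonZero; >-nonZero⁻¹; nonTrivial⇒n>1)
open import Data.Nat.Properties
open import Data.Nat.DivMod
open import Data.Nat.Divisibility using (divides; _∣0; ∣-refl; ∣m∣n⇒∣m+n; ∣-trans; n∣m*n; m∣m*n; m%n≡0⇒n∣m; n∣m⇒m%n≡0; *-monoʳ-∣)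
open import Data.Nat.Primality using (prime⇒nonTrivial; prime⇒nonZero)
open import Data.Nat.Tactic.RingSolver using (solve-∀)
open import Algebra.Properties.Semiring.Sum +-*-semiring using (sum; sum-syntax; ∑-distrib-+; sum-cong-≗; *-distribˡ-sum)
open import Data.Fin.Base as Fin using (Fin; toℕ; fromℕ<; combine; remQuot; punchIn; inject₁)
open import Data.Fin.Patterns
open import Data.Fin.Properties using (toℕ-injective; toℕ-fromℕ<; toℕ<n; toℕ-combine; combine-injective; remQuot-combine; combine-remQuot; inject₁-injective; punchIn-injective)
open import Data.Fin.Permutation using (Permutation′; permutation; _⟨$⟩ʳ_; _⟨$⟩ˡ_; inverseˡ; inverseʳ; id; reverse; _∘ₚ_)
open import Data.Product using (Σ; ∃; ∃₂; _×_; _,_; proj₁; proj₂; uncurry)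
open import Data.Unit using (tt)
open import Function.Base using (_∘_)
open import Relation.Nullary using (yes; no; contradiction)
open import Relation.Binary.PropositionalEquality

sumFin-⊞ : (K L : AddStr) (n : ℕ) (f : Fin n → AddStr.Carrier (K ⊞ L)) →
           sumFin (K ⊞ L) n f ≡ (sumFin K n (proj₁ ∘ f) , sumFin L n (proj₂ ∘ f))
sumFin-⊞ K L zero    f = refl
sumFin-⊞ K L (suc n) f rewrite sumFin-⊞ K L n (f ∘ Fin.suc) = refl

sumFin-cong : (K : AddStr) (n : ℕ) {f g : Fin n → AddStr.Carrier K} →
              (∀ i → f i ≡ g i) → sumFin K n f ≡ sumFin K n g
sumFin-cong K zero    f≗g = refl
sumFin-cong K (suc n) f≗g = cong₂ (AddStr._⊕_ K) (f≗g 0F) (sumFin-cong K n (f≗g ∘ Fin.suc))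

∑-const : ∀ n k → ∑[ i < n ] k ≡ n * k
∑-const zero    k = refl
∑-const (suc n) k = cong (k +_) (∑-const n k)

∑-toℕ-combine : ∀ {m k n} (x : Fin n → Fin m) (r : Fin n → Fin k) →
                ∑[ i < n ] toℕ (combine (x i) (r i)) ≡ k * ∑[ i < n ] toℕ (x i) + ∑[ i < n ] toℕ (r i)
∑-toℕ-combine {k = k} {n} x r = begin
  ∑[ i < n ] toℕ (combine (x i) (r i))
    ≡⟨ sum-cong-≗ (λ i → toℕ-combine (x i) (r i)) ⟩
  ∑[ i < n ] (k * toℕ (x i) + toℕ (r i))
    ≡⟨ ∑-distrib-+ (λ i → k * toℕ (x i)) (toℕ ∘ r) ⟩
  ∑[ i < n ] (k * toℕ (x i)) + ∑[ i < n ] toℕ (r i)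
    ≡⟨ cong (_+ ∑[ i < n ] toℕ (r i)) (*-distribˡ-sum k (toℕ ∘ x)) ⟨
  k * ∑[ i < n ] toℕ (x i) + ∑[ i < n ] toℕ (r i) ∎
  where open ≡-Reasoning

module _ (v : ℕ) .{{_ : NonZero v}} where

  0%n≡0 : 0 % v ≡ 0
  0%n≡0 = m<n⇒m%n≡m (>-nonZero⁻¹ v)

  toℕ-mod : ∀ a → toℕ (a mod v) ≡ a % v
  toℕ-mod a = toℕ-fromℕ< _

  %≡%⇒mod≡mod : ∀ {a b} → a % v ≡ b % v → a mod v ≡ b mod v
  %≡%⇒mod≡mod {a} {b} eq = toℕ-injective (trans (toℕ-mod a) (trans eq (sym (toℕ-mod b))))

  mod-toℕ : (c : Fin v) → toℕ c mod v ≡ c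
  mod-toℕ c = toℕ-injective (trans (toℕ-mod (toℕ c)) (m<n⇒m%n≡m (toℕ<n c)))

  [m%n+o]%n≡[m+o]%n : ∀ a b → (a % v + b) % v ≡ (a + b) % v
  [m%n+o]%n≡[m+o]%n a b = begin
    (a % v + b) % v           ≡⟨ %-distribˡ-+ (a % v) b v ⟩
    (a % v % v + b % v) % v   ≡⟨ cong (λ w → (w + b % v) % v) (m%n%n≡m%n a v) ⟩
    (a % v + b % v) % v       ≡⟨ %-distribˡ-+ a b v ⟨
    (a + b) % v               ∎
    where open ≡-Reasoning

  sumFin-Zmod-mod : ∀ n (g : Fin n → ℕ) → sumFin (Zmod v) n (λ i → g i mod v) ≡ sum g mod v
  sumFin-Zmod-mod zero    g = refl
  sumFin-Zmod-mod (suc n) g = %≡%⇒mod≡mod (begin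
    (toℕ (g 0F mod v) + toℕ (sumFin (Zmod v) n (λ i → g (Fin.suc i) mod v))) % v
      ≡⟨ cong (λ w → (toℕ (g 0F mod v) + toℕ w) % v) (sumFin-Zmod-mod n (g ∘ Fin.suc)) ⟩
    (toℕ (g 0F mod v) + toℕ (sum (g ∘ Fin.suc) mod v)) % v
      ≡⟨ cong₂ (λ a b → (a + b) % v) (toℕ-mod (g 0F)) (toℕ-mod (sum (g ∘ Fin.suc))) ⟩
    (g 0F % v + sum (g ∘ Fin.suc) % v) % v
      ≡⟨ %-distribˡ-+ (g 0F) _ v ⟨
    sum g % v ∎)
    where open ≡-Reasoning

  toℕ-sumFin-Zmod : ∀ n (f : Fin n → Fin v) → toℕ (sumFin (Zmod v) n f) ≡ sum (toℕ ∘ f) % v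
  toℕ-sumFin-Zmod n f = begin
    toℕ (sumFin (Zmod v) n f)                      ≡⟨ cong toℕ (sumFin-cong (Zmod v) n (sym ∘ mod-toℕ ∘ f)) ⟩
    toℕ (sumFin (Zmod v) n (λ i → toℕ (f i) mod v)) ≡⟨ cong toℕ (sumFin-Zmod-mod n (toℕ ∘ f)) ⟩
    toℕ (sum (toℕ ∘ f) mod v)                       ≡⟨ toℕ-mod _ ⟩
    sum (toℕ ∘ f) % v                               ∎
    where open ≡-Reasoning

-- Blowing up an MRS* along a lifting

module _ {d : ℕ} (Balanced : ∀ {n} → (Fin n → Fin d) → Set) where

  record Lifting (G G₁ : AddStr) (T : AddStr.Carrier G₁ → Set) : Set where
    field
      lift            : AddStr.Carrier G → Fin d → AddStr.Carrier G₁
      lift-∈          : ∀ g s → T (lift g s)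
      lift-injective  : ∀ {g g′ s s′} → lift g s ≡ lift g′ s′ → g ≡ g′ × s ≡ s′
      lift-surjective : ∀ t → T t → ∃₂ λ g s → lift g s ≡ t
      lift-sum        : ∀ {n} (g : Fin n → AddStr.Carrier G) (s : Fin n → Fin d) →
                        sumFin G n g ≡ AddStr.𝟘 G → Balanced s →
                        sumFin G₁ n (λ i → lift (g i) (s i)) ≡ AddStr.𝟘 G₁

  lifting-⊞ : ∀ K {L L₁ T} → Lifting L L₁ T → Lifting (K ⊞ L) (K ⊞ L₁) (T ∘ proj₂)
  lifting-⊞ K {L} {L₁} ℓ = record
    { lift            = λ (k , l) s → k , lift l s
    ; lift-∈          = λ (k , l) s → lift-∈ l s
    ; lift-injective  = λ eq → let l≡l′ , s≡s′ = lift-injective (cong proj₂ eq)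
                               in cong₂ _,_ (cong proj₁ eq) l≡l′ , s≡s′
    ; lift-surjective = λ (k , l₁) t∈T → let l , s , eq = lift-surjective l₁ t∈T
                                         in (k , l) , s , cong (k ,_) eq
    ; lift-sum        = sum⊞
    }
    where
    open Lifting ℓ
    sum⊞ : ∀ {n} (g : Fin n → AddStr.Carrier (K ⊞ L)) (s : Fin n → Fin d) →
           sumFin (K ⊞ L) n g ≡ AddStr.𝟘 (K ⊞ L) → Balanced s →
           sumFin (K ⊞ L₁) n (λ i → proj₁ (g i) , lift (proj₂ (g i)) (s i)) ≡ AddStr.𝟘 (K ⊞ L₁)
    sum⊞ {n} g s g-sum bal = trans (sumFin-⊞ K L₁ n _)
      (cong₂ _,_ (cong proj₁ split) (lift-sum (proj₂ ∘ g) s (cong proj₂ split) bal))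
      where
      split : (sumFin K n (proj₁ ∘ g) , sumFin L n (proj₂ ∘ g)) ≡ AddStr.𝟘 (K ⊞ L)
      split = trans (sym (sumFin-⊞ K L n g)) g-sum

  record BalancedPattern (x y : ℕ) : Set where
    field
      perm          : Fin x → Fin y → Permutation′ d
      rows-balanced : ∀ i s → Balanced (λ j → perm i j ⟨$⟩ʳ s)
      cols-balanced : ∀ j s → Balanced (λ i → perm i j ⟨$⟩ʳ s)

  module _ {G G₁ T x y z} (ℓ : Lifting G G₁ T) (P : BalancedPattern x y) (mrs : MRS G x y z) where
    open Lifting ℓ
    open BalancedPattern P
    private module A = IMRS mrs

    blownUp : Fin d → Fin z → Fin x → Fin y → AddStr.Carrier G₁
    blownUp s k i j = lift (A.A k i j) (perm i j ⟨$⟩ʳ s)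

    blownUp-exactlyOnce : ∀ t → T t →
      Σ (Fin d × Fin z × Fin x × Fin y) λ (s , k , i , j) → blownUp s k i j ≡ t ×
        (∀ s′ k′ i′ j′ → blownUp s′ k′ i′ j′ ≡ t → (s′ , k′ , i′ , j′) ≡ (s , k , i , j))
    blownUp-exactlyOnce t t∈T with lift-surjective t t∈T
    ... | g , σ , lift≡t with A.exactlyOnce g tt
    ... | (k , i , j) , A≡g , A-unique = (perm i j ⟨$⟩ˡ σ , k , i , j) , hit , unique
      where
      hit : blownUp (perm i j ⟨$⟩ˡ σ) k i j ≡ t
      hit = trans (cong₂ lift A≡g (inverseʳ (perm i j))) lift≡t
      unique : ∀ s′ k′ i′ j′ → blownUp s′ k′ i′ j′ ≡ t → (s′ , k′ , i′ , j′) ≡ (perm i j ⟨$⟩ˡ σ , k , i , j)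
      unique s′ k′ i′ j′ eq with lift-injective (trans eq (sym lift≡t))
      ... | A′≡g , perm′≡σ with A-unique k′ i′ j′ A′≡g
      ... | refl = cong (_, k , i , j) (trans (sym (inverseˡ (perm i j))) (cong (perm i j ⟨$⟩ˡ_) perm′≡σ))

    blowUp : IMRS G₁ T x y (d * z)
    blowUp = record
      { A           = A′
      ; entriesInT  = λ kk i j → lift-∈ _ _
      ; exactlyOnce = exactlyOnce′
      ; rowSums     = λ kk i → let s , k = remQuot z kk in
                        lift-sum _ _ (A.rowSums k i) (rows-balanced i s)
      ; colSums     = λ kk j → let s , k = remQuot z kk in
                        lift-sum _ _ (A.colSums k j) (cols-balanced j s)
      }
      where
      A′ : Fin (d * z) → Fin x → Fin y → AddStr.Carrier G₁
      A′ kk = uncurry blownUp (remQuot z kk)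
      exactlyOnce′ : ∀ t → T t → Σ (Fin (d * z) × Fin x × Fin y) λ (kk , i , j) → A′ kk i j ≡ t ×
                       (∀ kk′ i′ j′ → A′ kk′ i′ j′ ≡ t → (kk′ , i′ , j′) ≡ (kk , i , j))
      exactlyOnce′ t t∈T with blownUp-exactlyOnce t t∈T
      ... | (s , k , i , j) , hit , unique = (combine s k , i , j) , hit′ , unique′
        where
        hit′ : A′ (combine s k) i j ≡ t
        hit′ = trans (cong (λ sk → uncurry blownUp sk i j) (remQuot-combine s k)) hit
        unique′ : ∀ kk′ i′ j′ → A′ kk′ i′ j′ ≡ t → (kk′ , i′ , j′) ≡ (combine s k , i , j)
        unique′ kk′ i′ j′ eq = trans (cong (_, i′ , j′) (sym (combine-remQuot {d} z kk′)))
          (cong (λ (s , k , i , j) → combine s k , i , j) (unique _ _ i′ j′ eq))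

-- The digit encoding ℤ_M × D → ℤ_{8M} ∖ 4ℤ_{8M}

digit : Fin 6 → Fin 8
digit = inject₁ ∘ punchIn 3F

Balanced : ∀ {n} → (Fin n → Fin 6) → Set
Balanced {n} s = ∑[ i < n ] toℕ (digit (s i)) ≡ 3 * n

digit-injective : ∀ {s s′} → digit s ≡ digit s′ → s ≡ s′
digit-injective eq = punchIn-injective 3F _ _ (inject₁-injective eq)

digit≢3[mod4] : ∀ s → toℕ (digit s) % 4 ≢ 3
digit≢3[mod4] 0F ()
digit≢3[mod4] 1F ()
digit≢3[mod4] 2F ()
digit≢3[mod4] 3F ()
digit≢3[mod4] 4F ()
digit≢3[mod4] 5F ()

≢3[mod4]⇒digit : ∀ r → toℕ r % 4 ≢ 3 → ∃ λ s → digit s ≡ r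
≢3[mod4]⇒digit 0F _ = 0F , refl
≢3[mod4]⇒digit 1F _ = 1F , refl
≢3[mod4]⇒digit 2F _ = 2F , refl
≢3[mod4]⇒digit 3F r≢3 = contradiction refl r≢3
≢3[mod4]⇒digit 4F _ = 3F , refl
≢3[mod4]⇒digit 5F _ = 4F , refl
≢3[mod4]⇒digit 6F _ = 5F , refl
≢3[mod4]⇒digit 7F r≢3 = contradiction refl r≢3

module DigitEncoding {M N : ℕ} .{{_ : NonZero M}} .{{_ : NonZero N}} (N≡M*8 : N ≡ M * 8) where

  MultipleOf4 : Fin N → Set
  MultipleOf4 c = Σ (Fin N) λ y → c ≡ (4 * toℕ y) mod N

  3≤N : 3 ≤ N
  3≤N = subst (3 ≤_) (sym N≡M*8) (≤-trans (m≤m+n 3 5) (m≤n*m 8 M))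

  4∣N : 4 ∣ N
  4∣N = subst (4 ∣_) (sym N≡M*8) (∣-trans (divides 2 refl) (n∣m*n M))

  toℕ-combine<N : ∀ (x : Fin M) (r : Fin 8) → toℕ (combine x r) < N
  toℕ-combine<N x r = subst (toℕ (combine x r) <_) (sym N≡M*8) (toℕ<n (combine x r))

  sub3 : ℕ → Fin N
  sub3 a = (a + (N ∸ 3)) mod N

  add3 : Fin N → ℕ
  add3 c = (toℕ c + 3) % N

  [m+3+[N∸3]]%N≡m%N : ∀ a → (a + 3 + (N ∸ 3)) % N ≡ a % N
  [m+3+[N∸3]]%N≡m%N a = begin
    (a + 3 + (N ∸ 3)) % N   ≡⟨ cong (_% N) (+-assoc a 3 (N ∸ 3)) ⟩
    (a + (3 + (N ∸ 3))) % N ≡⟨ cong (λ w → (a + w) % N) (m+[n∸m]≡n 3≤N) ⟩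
    (a + N) % N             ≡⟨ [m+n]%n≡m%n a N ⟩
    a % N                   ∎
    where open ≡-Reasoning

  add3-sub3 : ∀ a → add3 (sub3 a) ≡ a % N
  add3-sub3 a = begin
    (toℕ (sub3 a) + 3) % N          ≡⟨ cong (λ w → (w + 3) % N) (toℕ-mod N _) ⟩
    ((a + (N ∸ 3)) % N + 3) % N     ≡⟨ [m%n+o]%n≡[m+o]%n N _ 3 ⟩
    (a + (N ∸ 3) + 3) % N           ≡⟨ cong (_% N) (+-assoc a (N ∸ 3) 3) ⟩
    (a + ((N ∸ 3) + 3)) % N         ≡⟨ cong (λ w → (a + w) % N) (m∸n+n≡m 3≤N) ⟩
    (a + N) % N                     ≡⟨ [m+n]%n≡m%n a N ⟩
    a % N                           ∎
    where open ≡-Reasoning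

  sub3-add3 : ∀ c → sub3 (add3 c) ≡ c
  sub3-add3 c = toℕ-injective (begin
    toℕ (sub3 (add3 c))             ≡⟨ toℕ-mod N _ ⟩
    ((toℕ c + 3) % N + (N ∸ 3)) % N ≡⟨ [m%n+o]%n≡[m+o]%n N _ (N ∸ 3) ⟩
    (toℕ c + 3 + (N ∸ 3)) % N       ≡⟨ [m+3+[N∸3]]%N≡m%N (toℕ c) ⟩
    toℕ c % N                       ≡⟨ m<n⇒m%n≡m (toℕ<n c) ⟩
    toℕ c                           ∎)
    where open ≡-Reasoning

  sub3-+3 : ∀ a → sub3 (a + 3) ≡ a mod N
  sub3-+3 a = %≡%⇒mod≡mod N ([m+3+[N∸3]]%N≡m%N a)

  sub3-injective : ∀ {a b} → a < N → b < N → sub3 a ≡ sub3 b → a ≡ b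
  sub3-injective {a} {b} a<N b<N eq = begin
    a              ≡⟨ m<n⇒m%n≡m a<N ⟨
    a % N          ≡⟨ add3-sub3 a ⟨
    add3 (sub3 a)  ≡⟨ cong add3 eq ⟩
    add3 (sub3 b)  ≡⟨ add3-sub3 b ⟩
    b % N          ≡⟨ m<n⇒m%n≡m b<N ⟩
    b              ∎
    where open ≡-Reasoning

  sub3-multipleOf4⇒≡3[mod4] : ∀ {a} → a < N → MultipleOf4 (sub3 a) → a % 4 ≡ 3
  sub3-multipleOf4⇒≡3[mod4] {a} a<N (y , eq) = begin
    a % 4                   ≡⟨ cong (_% 4) a≡[4y+3]%N ⟩
    (4 * toℕ y + 3) % N % 4 ≡⟨ m∣n⇒o%n%m≡o%m 4 N _ 4∣N ⟩
    (4 * toℕ y + 3) % 4     ≡⟨ %-remove-+ˡ 3 (m∣m*n (toℕ y)) ⟩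
    3                       ∎
    where
    open ≡-Reasoning
    a≡[4y+3]%N : a ≡ (4 * toℕ y + 3) % N
    a≡[4y+3]%N = begin
      a                           ≡⟨ m<n⇒m%n≡m a<N ⟨
      a % N                       ≡⟨ add3-sub3 a ⟨
      add3 (sub3 a)               ≡⟨ cong add3 (trans eq (sym (sub3-+3 _))) ⟩
      add3 (sub3 (4 * toℕ y + 3)) ≡⟨ add3-sub3 _ ⟩
      (4 * toℕ y + 3) % N         ∎

  ≡3[mod4]⇒sub3-multipleOf4 : ∀ {a} → a < N → a % 4 ≡ 3 → MultipleOf4 (sub3 a)
  ≡3[mod4]⇒sub3-multipleOf4 {a} a<N a≡3 = fromℕ< a/4<N , (begin
    sub3 a                         ≡⟨ cong sub3 a≡4q+3 ⟩
    sub3 (4 * (a / 4) + 3)         ≡⟨ sub3-+3 _ ⟩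
    (4 * (a / 4)) mod N            ≡⟨ cong (λ w → (4 * w) mod N) (toℕ-fromℕ< a/4<N) ⟨
    (4 * toℕ (fromℕ< a/4<N)) mod N ∎)
    where
    open ≡-Reasoning
    a/4<N : a / 4 < N
    a/4<N = ≤-<-trans (m/n≤m a 4) a<N
    a≡4q+3 : a ≡ 4 * (a / 4) + 3
    a≡4q+3 = begin
      a                    ≡⟨ m≡m%n+[m/n]*n a 4 ⟩
      a % 4 + a / 4 * 4    ≡⟨ cong (_+ a / 4 * 4) a≡3 ⟩
      3 + a / 4 * 4        ≡⟨ +-comm 3 _ ⟩
      a / 4 * 4 + 3        ≡⟨ cong (_+ 3) (*-comm (a / 4) 4) ⟩
      4 * (a / 4) + 3      ∎

  combine≡[mod4] : ∀ (x : Fin M) (r : Fin 8) → toℕ (combine x r) % 4 ≡ toℕ r % 4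
  combine≡[mod4] x r = trans (cong (_% 4) (toℕ-combine x r))
                             (%-remove-+ˡ (toℕ r) (∣-trans (divides 2 refl) (m∣m*n (toℕ x))))

  enc : Fin M → Fin 6 → Fin N
  enc x s = sub3 (toℕ (combine x (digit s)))

  enc-∉4ℤ : ∀ x s → ¬ MultipleOf4 (enc x s)
  enc-∉4ℤ x s m4 = digit≢3[mod4] s
    (trans (sym (combine≡[mod4] x (digit s))) (sub3-multipleOf4⇒≡3[mod4] (toℕ-combine<N x (digit s)) m4))

  enc-injective : ∀ {x x′ s s′} → enc x s ≡ enc x′ s′ → x ≡ x′ × s ≡ s′
  enc-injective {x} {x′} {s} {s′} eq =
    let x≡x′ , r≡r′ = combine-injective x (digit s) x′ (digit s′)
                        (toℕ-injective (sub3-injective (toℕ-combine<N _ _) (toℕ-combine<N _ _) eq))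
    in x≡x′ , digit-injective r≡r′

  sub3-combine-surjective : ∀ c → ∃₂ λ (x : Fin M) (r : Fin 8) → sub3 (toℕ (combine x r)) ≡ c
  sub3-combine-surjective c = x , r , (begin
    sub3 (toℕ (combine x r)) ≡⟨ cong (sub3 ∘ toℕ) (combine-remQuot {M} 8 d) ⟩
    sub3 (toℕ d)             ≡⟨ cong sub3 (toℕ-fromℕ< add3<M*8) ⟩
    sub3 (add3 c)            ≡⟨ sub3-add3 c ⟩
    c                        ∎)
    where
    open ≡-Reasoning
    add3<M*8 : add3 c < M * 8
    add3<M*8 = subst (add3 c <_) N≡M*8 (m%n<n _ N)
    d : Fin (M * 8)
    d = fromℕ< add3<M*8
    x : Fin M
    x = proj₁ (remQuot {M} 8 d)
    r : Fin 8
    r = proj₂ (remQuot {M} 8 d)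

  enc-surjective : ∀ c → ¬ MultipleOf4 c → ∃₂ λ x s → enc x s ≡ c
  enc-surjective c c∉4ℤ with sub3-combine-surjective c
  ... | x , r , eq with toℕ r % 4 ≟ 3
  ... | yes r≡3 = contradiction (subst MultipleOf4 eq
                    (≡3[mod4]⇒sub3-multipleOf4 (toℕ-combine<N x r) (trans (combine≡[mod4] x r) r≡3))) c∉4ℤ
  ... | no r≢3 with ≢3[mod4]⇒digit r r≢3
  ...   | s , refl = x , s , eq

  enc-sum : ∀ {n} (x : Fin n → Fin M) (s : Fin n → Fin 6) →
            sumFin (Zmod M) n x ≡ 0 mod M → Balanced s →
            sumFin (Zmod N) n (λ i → enc (x i) (s i)) ≡ 0 mod N
  enc-sum {n} x s x-sum balanced = trans (sumFin-Zmod-mod N n shifted) (%≡%⇒mod≡mod N (begin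
    sum shifted % N                  ≡⟨ cong (_% N) sum-shifted ⟩
    (8 * X + n * N) % N              ≡⟨ [m+kn]%n≡m%n (8 * X) n N ⟩
    (8 * X) % N                      ≡⟨ n∣m⇒m%n≡0 _ N N∣8X ⟩
    0                                ≡⟨ 0%n≡0 N ⟨
    0 % N                            ∎))
    where
    open ≡-Reasoning
    X : ℕ
    X = ∑[ i < n ] toℕ (x i)
    shifted : Fin n → ℕ
    shifted i = toℕ (combine (x i) (digit (s i))) + (N ∸ 3)
    X%M≡0 : X % M ≡ 0
    X%M≡0 = begin
      X % M                      ≡⟨ toℕ-sumFin-Zmod M n x ⟨
      toℕ (sumFin (Zmod M) n x)  ≡⟨ cong toℕ x-sum ⟩
      toℕ (0 mod M)              ≡⟨ toℕ-mod M 0 ⟩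
      0 % M                      ≡⟨ 0%n≡0 M ⟩
      0                          ∎
    N∣8X : N ∣ 8 * X
    N∣8X = subst (_∣ 8 * X) (trans (*-comm 8 M) (sym N≡M*8)) (*-monoʳ-∣ 8 (m%n≡0⇒n∣m X M X%M≡0))
    sum-shifted : sum shifted ≡ 8 * X + n * N
    sum-shifted = begin
      sum shifted
        ≡⟨ ∑-distrib-+ (λ i → toℕ (combine (x i) (digit (s i)))) (λ _ → N ∸ 3) ⟩
      ∑[ i < n ] toℕ (combine (x i) (digit (s i))) + ∑[ i < n ] (N ∸ 3)
        ≡⟨ cong₂ _+_ (∑-toℕ-combine x (digit ∘ s)) (∑-const n (N ∸ 3)) ⟩
      8 * X + ∑[ i < n ] toℕ (digit (s i)) + n * (N ∸ 3)
        ≡⟨ cong (λ b → 8 * X + b + n * (N ∸ 3)) balanced ⟩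
      8 * X + 3 * n + n * (N ∸ 3)
        ≡⟨ regroup (8 * X) n (N ∸ 3) ⟩
      8 * X + n * (3 + (N ∸ 3))
        ≡⟨ cong (λ w → 8 * X + n * w) (m+[n∸m]≡n 3≤N) ⟩
      8 * X + n * N ∎
      where
      regroup : ∀ a n k → a + 3 * n + n * k ≡ a + n * (3 + k)
      regroup = solve-∀

  digitLifting : Lifting Balanced (Zmod M) (Zmod N) (λ c → ¬ MultipleOf4 c)
  digitLifting = record
    { lift            = enc
    ; lift-∈          = enc-∉4ℤ
    ; lift-injective  = enc-injective
    ; lift-surjective = enc-surjective
    ; lift-sum        = enc-sum
    }

-- Balanced digit patterns for an odd number of rows

digit-reverse : ∀ s → toℕ (digit (reverse ⟨$⟩ʳ s)) + toℕ (digit s) ≡ 6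
digit-reverse 0F = refl
digit-reverse 1F = refl
digit-reverse 2F = refl
digit-reverse 3F = refl
digit-reverse 4F = refl
digit-reverse 5F = refl

reverse-balanced : ∀ {n} (t : Fin n → Fin 6) → Balanced t → Balanced (λ i → reverse ⟨$⟩ʳ t i)
reverse-balanced {n} t balanced = +-cancelʳ-≡ (3 * n) _ _ (begin
  ∑[ i < n ] toℕ (digit (reverse ⟨$⟩ʳ t i)) + 3 * n
    ≡⟨ cong (∑[ i < n ] toℕ (digit (reverse ⟨$⟩ʳ t i)) +_) balanced ⟨
  ∑[ i < n ] toℕ (digit (reverse ⟨$⟩ʳ t i)) + ∑[ i < n ] toℕ (digit (t i))
    ≡⟨ ∑-distrib-+ (λ i → toℕ (digit (reverse ⟨$⟩ʳ t i))) (λ i → toℕ (digit (t i))) ⟨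
  ∑[ i < n ] (toℕ (digit (reverse ⟨$⟩ʳ t i)) + toℕ (digit (t i)))
    ≡⟨ sum-cong-≗ (digit-reverse ∘ t) ⟩
  ∑[ i < n ] 6
    ≡⟨ ∑-const n 6 ⟩
  n * 6
    ≡⟨ halve n ⟩
  3 * n + 3 * n ∎)
  where
  open ≡-Reasoning
  halve : ∀ n → n * 6 ≡ 3 * n + 3 * n
  halve = solve-∀

ρ : Fin 6 → Fin 6
ρ 0F = 3F
ρ 3F = 4F
ρ 4F = 0F
ρ 5F = 2F
ρ 2F = 1F
ρ 1F = 5F

ρ³≡id : ∀ s → ρ (ρ (ρ s)) ≡ s
ρ³≡id 0F = refl
ρ³≡id 1F = refl
ρ³≡id 2F = refl
ρ³≡id 3F = refl
ρ³≡id 4F = refl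
ρ³≡id 5F = refl

digit-orbit : ∀ s → toℕ (digit s) + (toℕ (digit (ρ s)) + toℕ (digit (ρ (ρ s)))) ≡ 9
digit-orbit 0F = refl
digit-orbit 1F = refl
digit-orbit 2F = refl
digit-orbit 3F = refl
digit-orbit 4F = refl
digit-orbit 5F = refl

rotation : Permutation′ 6
rotation = permutation ρ (ρ ∘ ρ) ρ³≡id ρ³≡id

alternating : ℕ → Permutation′ 6
alternating zero          = id
alternating (suc zero)    = reverse
alternating (suc (suc k)) = alternating k

alternating-balanced : ∀ m s → Balanced {m * 2} (λ i → alternating (toℕ i) ⟨$⟩ʳ s)
alternating-balanced zero    s = refl
alternating-balanced (suc m) s = begin
  toℕ (digit s) + (toℕ (digit (reverse ⟨$⟩ʳ s)) + S)
    ≡⟨ +-assoc (toℕ (digit s)) _ S ⟨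
  toℕ (digit s) + toℕ (digit (reverse ⟨$⟩ʳ s)) + S
    ≡⟨ cong₂ _+_ (trans (+-comm (toℕ (digit s)) _) (digit-reverse s)) (alternating-balanced m s) ⟩
  6 + 3 * (m * 2)
    ≡⟨ *-distribˡ-+ 3 2 (m * 2) ⟨
  3 * (suc m * 2) ∎
  where
  open ≡-Reasoning
  S : ℕ
  S = ∑[ i < m * 2 ] toℕ (digit (alternating (toℕ i) ⟨$⟩ʳ s))

alternating-preserves-balanced : ∀ k {n} (t : Fin n → Fin 6) → Balanced t →
                                 Balanced (λ i → alternating k ⟨$⟩ʳ t i)
alternating-preserves-balanced zero          t balanced = balanced
alternating-preserves-balanced (suc zero)    t balanced = reverse-balanced t balanced
alternating-preserves-balanced (suc (suc k)) t balanced = alternating-preserves-balanced k t balanced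

rowPermutation : ℕ → Permutation′ 6
rowPermutation zero                = id
rowPermutation (suc zero)          = rotation
rowPermutation (suc (suc zero))    = rotation ∘ₚ rotation
rowPermutation (suc (suc (suc k))) = alternating k

rowPermutation-balanced : ∀ m s → Balanced {3 + m * 2} (λ i → rowPermutation (toℕ i) ⟨$⟩ʳ s)
rowPermutation-balanced m s = begin
  a + (b + (c + S))    ≡⟨ cong (a +_) (+-assoc b c S) ⟨
  a + (b + c + S)      ≡⟨ +-assoc a (b + c) S ⟨
  a + (b + c) + S      ≡⟨ cong₂ _+_ (digit-orbit s) (alternating-balanced m s) ⟩
  9 + 3 * (m * 2)      ≡⟨ *-distribˡ-+ 3 3 (m * 2) ⟨
  3 * (3 + m * 2)      ∎
  where
  open ≡-Reasoning
  a b c S : ℕ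
  a = toℕ (digit s)
  b = toℕ (digit (ρ s))
  c = toℕ (digit (ρ (ρ s)))
  S = ∑[ i < m * 2 ] toℕ (digit (alternating (toℕ i) ⟨$⟩ʳ s))

oddPattern : ∀ m k → BalancedPattern Balanced (3 + m * 2) (k * 2)
oddPattern m k = record
  { perm          = λ i j → rowPermutation (toℕ i) ∘ₚ alternating (toℕ j)
  ; rows-balanced = λ i s → alternating-balanced k (rowPermutation (toℕ i) ⟨$⟩ʳ s)
  ; cols-balanced = λ j s → alternating-preserves-balanced (toℕ j) (λ i → rowPermutation (toℕ i) ⟨$⟩ʳ s)
                                                             (rowPermutation-balanced m s)
  }

odd⇒≡1+m*2 : ∀ {n} → ¬ 2 ∣ n → ∃ λ m → n ≡ 1 + m * 2
odd⇒≡1+m*2 {zero}        ¬2∣n = contradiction (2 ∣0) ¬2∣n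
odd⇒≡1+m*2 {suc zero}    _    = 0 , refl
odd⇒≡1+m*2 {suc (suc n)} ¬2∣n with odd⇒≡1+m*2 {n} (¬2∣n ∘ ∣m∣n⇒∣m+n ∣-refl)
... | m , refl = suc m , refl

balancedPattern : ∀ {n} k → 1 < n → ¬ 2 ∣ n → BalancedPattern Balanced n (k * 2)
balancedPattern k 1<n ¬2∣n with odd⇒≡1+m*2 ¬2∣n
... | zero  , refl = contradiction 1<n (<-irrefl refl)
... | suc m , refl = oddPattern m k

mainTheorem12 : (α p : ℕ) (pp : Prime p) → ¬ (2 ∣ p) → (H : FinAbGroup) →
                MRS (Grp p pp H α) p 4 (div4p (card p H α) p pp) →
                IMRS (Grp p pp H (α + 3)) (notInG2 p pp H α) p 4
                     (6 * div4p (card p H α) p pp)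
mainTheorem12 α p pp ¬2∣p H mrs = blowUp Balanced lifting (balancedPattern 2 1<p ¬2∣p) mrs
  where
  1<p : 1 < p
  1<p = nonTrivial⇒n>1 p {{prime⇒nonTrivial pp}}
  lifting : Lifting Balanced (Grp p pp H α) (Grp p pp H (α + 3)) (notInG2 p pp H α)
  lifting = lifting-⊞ Balanced (Zmod p {{prime⇒nonZero pp}}) (lifting-⊞ Balanced (toAddStr H)
              (DigitEncoding.digitLifting {{m^n≢0 2 α}} {{m^n≢0 2 (α + 3)}} (^-distribˡ-+-* 2 α 3)))
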